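{- Let $D$ be a nontrivial even semicomplete digraph with exactly one peripheral vertex, and let $v\in V(D)$ be any prescribed vertex. Then there is a map $\varphi:A(D)\to\{1,2\}$ such that condition (WO) holds at every vertex of $D$ other than $v$.
   Context: All digraphs are finite, without loops or parallel arcs (a pair of opposite arcs $uv, vu$ is allowed). A digraph $D$ is semicomplete if every pair of distinct vertices is joined by at least one arc (in one or both directions). For a vertex $u$, the semi-cuts of $u$ are $\partial_D^+(u)=\{uw\in A(D)\}$ and $\partial_D^-(u)=\{wu\in A(D)\}$, with $d_D^\pm(u)=|\partial_D^\pm(u)|$ and $d_D(u)=d_D^+(u)+d_D^-(u)$. A map $\varphi:A(D)\to\{1,2\}$ satisfies condition (WO) at $u$ if there is a color $i\in\{1,2\}$ such that every nonempty semi-cut of $u$ contains an odd number of arcs of color $i$. A vertex $u$ is peripheral if $d_D^+(u)=0$ or $d_D^-(u)=0$. $D$ is even if $d_D(u)$ is even for every $u$; nontrivial means more than one vertex. -}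

module Defs where

open import Data.Nat using (ℕ; zero; suc; _+_; _%_; _>_)
open import Data.Bool using (Bool; true; false; _∧_; _∨_; T)
open import Data.Fin using (Fin; zero; suc)
open import Data.Fin.Properties using (_≟_)
open import Data.Product using (Σ; ∃; _×_; _,_)
open import Data.Sum using (_⊎_)
open import Relation.Binary.PropositionalEquality using (_≡_; _≢_)
open import Relation.Nullary using (¬_)
open import Relation.Nullary.Decidable using (⌊_⌋)

count : {n : ℕ} → (Fin n → Bool) → ℕ
count {zero}  p = 0
count {suc n} p = (if-one (p zero)) + count (λ x → p (suc x))
  where
  if-one : Bool → ℕ
  if-one true  = 1
  if-one false = 0

-- A digraph on vertex set Fin n: arc relation (u , w) ∈ A(D) iff arc D u w ≡ true.
-- No loops; opposite arcs allowed; no parallel arcs (automatic for a relation).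
record Digraph (n : ℕ) : Set where
  field
    arc    : Fin n → Fin n → Bool
    noLoop : ∀ u → arc u u ≡ false
open Digraph public

Semicomplete : {n : ℕ} → Digraph n → Set
Semicomplete {n} D = ∀ (u w : Fin n) → u ≢ w → T (arc D u w ∨ arc D w u)

outdeg : {n : ℕ} → Digraph n → Fin n → ℕ
outdeg D u = count (λ w → arc D u w)

indeg : {n : ℕ} → Digraph n → Fin n → ℕ
indeg D u = count (λ w → arc D w u)

deg : {n : ℕ} → Digraph n → Fin n → ℕ
deg D u = outdeg D u + indeg D u

IsEven IsOdd : ℕ → Set
IsEven k = k % 2 ≡ 0
IsOdd  k = k % 2 ≡ 1

EvenDigraph : {n : ℕ} → Digraph n → Set
EvenDigraph {n} D = ∀ (u : Fin n) → IsEven (deg D u)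

Peripheral : {n : ℕ} → Digraph n → Fin n → Set
Peripheral D u = outdeg D u ≡ 0 ⊎ indeg D u ≡ 0

ExactlyOnePeripheral : {n : ℕ} → Digraph n → Set
ExactlyOnePeripheral {n} D =
  Σ (Fin n) λ p → Peripheral D p × (∀ (u : Fin n) → Peripheral D u → u ≡ p)

-- A colouring φ : A(D) → {1,2}, represented on all ordered pairs (values on
-- non-arcs are irrelevant); colour 1 ↦ zero, colour 2 ↦ suc zero.
Colouring : ℕ → Set
Colouring n = Fin n → Fin n → Fin 2

outCol inCol : {n : ℕ} → Digraph n → Colouring n → Fin 2 → Fin n → ℕ
outCol D φ i u = count (λ w → arc D u w ∧ ⌊ φ u w ≟ i ⌋)
inCol  D φ i u = count (λ w → arc D w u ∧ ⌊ φ w u ≟ i ⌋)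

WO : {n : ℕ} → Digraph n → Colouring n → Fin n → Set
WO D φ u = Σ (Fin 2) λ i →
  (outdeg D u > 0 → IsOdd (outCol D φ i u)) ×
  (indeg D u > 0 → IsOdd (inCol D φ i u))

{-# OPTIONS --safe #-}
-- We may assume the unique peripheral vertex p is a sink: otherwise reverse every arc,
-- which swaps the two semi-cuts of each vertex. Only colour 1 is ever made odd. Each
-- w ≠ p has an in-neighbour, and exactly one arc into w gets colour 1. Each u ≠ p has
-- an arc to p by semicompleteness, and its colour fixes the parity of u's out-cut. The
-- arcs into p are thereby coloured, except the one from v: as (WO) is waived at v, it
-- is free, and its colour fixes the parity of p's in-cut.
module Submission where

open import Defs
open import Data.Nat using (ℕ; zero; suc; _+_; _>_; parity)
open import Data.Nat.Properties using (+-suc; <⇒≢)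
open import Data.Parity.Base using (0ℙ; 1ℙ)
open import Data.Parity.Properties using (+-homo-+) renaming (_≟_ to _≟ℙ_)
open import Data.Fin using (Fin; zero; suc)
open import Data.Fin.Properties using (_≟_; any?)
open import Data.Bool using (Bool; true; false; _∧_; _∨_; not; T; if_then_else_)
open import Data.Bool.Properties using (∧-zeroʳ; ∨-identityʳ; ∨-comm; T-≡) renaming (_≟_ to _≟ᵇ_)
open import Data.Product using (Σ; ∃; _,_)
open import Data.Sum using (inj₁; inj₂; swap)
open import Data.Empty using (⊥-elim)
open import Relation.Nullary using (Dec; yes; no)
open import Relation.Nullary.Decidable using (⌊_⌋)
open import Relation.Binary.PropositionalEquality
  using (_≡_; _≢_; refl; sym; trans; cong; cong₂; subst; module ≡-Reasoning)
open import Function.Base using (_∘_; flip)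
open import Function.Bundles using (Equivalence)

private
  variable
    n : ℕ

count-cong : {f g : Fin n → Bool} → (∀ x → f x ≡ g x) → count f ≡ count g
count-cong {zero}  f≗g = refl
count-cong {suc n} {f} {g} f≗g with f zero | g zero | f≗g zero
... | false | .false | refl = count-cong (λ x → f≗g (suc x))
... | true  | .true  | refl = cong suc (count-cong (λ x → f≗g (suc x)))

count-∧-false : (f : Fin n → Bool) → count (λ x → f x ∧ false) ≡ 0
count-∧-false {zero}  f = refl
count-∧-false {suc n} f rewrite ∧-zeroʳ (f zero) = count-∧-false (λ x → f (suc x))

count-split : (f g : Fin n → Bool) →
  count f ≡ count (λ x → f x ∧ g x) + count (λ x → f x ∧ not (g x))
count-split {zero}  f g = refl
count-split {suc n} f g with f zero | g zero
... | false | _     = count-split (λ x → f (suc x)) (λ x → g (suc x))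
... | true  | true  = cong suc (count-split (λ x → f (suc x)) (λ x → g (suc x)))
... | true  | false = trans (cong suc (count-split (λ x → f (suc x)) (λ x → g (suc x))))
                            (sym (+-suc _ _))

suc≟suc : (x y : Fin n) → ⌊ suc x ≟ suc y ⌋ ≡ ⌊ x ≟ y ⌋
suc≟suc x y with x ≟ y
... | yes _ = refl
... | no _  = refl

count-except-cong : {f g : Fin n → Bool} (k : Fin n) → (∀ x → x ≢ k → f x ≡ g x) →
  count (λ x → f x ∧ not ⌊ x ≟ k ⌋) ≡ count (λ x → g x ∧ not ⌊ x ≟ k ⌋)
count-except-cong {f = f} {g} k f≗g = count-cong agree
  where
  agree : ∀ x → f x ∧ not ⌊ x ≟ k ⌋ ≡ g x ∧ not ⌊ x ≟ k ⌋
  agree x with x ≟ k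
  ... | yes _   = trans (∧-zeroʳ (f x)) (sym (∧-zeroʳ (g x)))
  ... | no x≢k  = cong (_∧ true) (f≗g x x≢k)

count-at : (f : Fin n → Bool) (k : Fin n) →
  count (λ x → f x ∧ ⌊ x ≟ k ⌋) ≡ (if f k then 1 else 0)
count-at {suc n} f zero with f zero
... | true  = cong suc (count-∧-false (λ x → f (suc x)))
... | false = count-∧-false (λ x → f (suc x))
count-at {suc n} f (suc k) rewrite ∧-zeroʳ (f zero) =
  trans (count-cong (λ x → cong (f (suc x) ∧_) (suc≟suc x k))) (count-at (λ x → f (suc x)) k)

count≡0⇒false : (f : Fin n → Bool) → count f ≡ 0 → ∀ x → f x ≡ false
count≡0⇒false {suc n} f count≡0 x with f zero in f0≡
count≡0⇒false {suc n} f count≡0 zero    | false = f0≡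
count≡0⇒false {suc n} f count≡0 (suc x) | false = count≡0⇒false (λ y → f (suc y)) count≡0 x

count≢0⇒∃ : (f : Fin n → Bool) → count f ≢ 0 → ∃ λ x → f x ≡ true
count≢0⇒∃ {zero}  f count≢0 = ⊥-elim (count≢0 refl)
count≢0⇒∃ {suc n} f count≢0 with f zero in f0≡
... | true  = zero , f0≡
... | false with count≢0⇒∃ (λ y → f (suc y)) count≢0
...   | x , fx≡ = suc x , fx≡

parity≡1ℙ⇒odd : ∀ m → parity m ≡ 1ℙ → IsOdd m
parity≡1ℙ⇒odd 1             _ = refl
parity≡1ℙ⇒odd (suc (suc m)) p = parity≡1ℙ⇒odd m p

evenᵇ : ℕ → Bool
evenᵇ m = ⌊ parity m ≟ℙ 0ℙ ⌋

parity-completed : ∀ m → parity ((if evenᵇ m then 1 else 0) + m) ≡ 1ℙ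
parity-completed m rewrite +-homo-+ (if evenᵇ m then 1 else 0) m with parity m
... | 0ℙ = refl
... | 1ℙ = refl

count-odd-by-pivot : (f : Fin n → Bool) (k : Fin n) →
  f k ≡ evenᵇ (count (λ x → f x ∧ not ⌊ x ≟ k ⌋)) → IsOdd (count f)
count-odd-by-pivot f k fk≡ = parity≡1ℙ⇒odd (count f) (begin
  parity (count f)
    ≡⟨ cong parity (count-split f (λ x → ⌊ x ≟ k ⌋)) ⟩
  parity (count (λ x → f x ∧ ⌊ x ≟ k ⌋) + rest)
    ≡⟨ cong (λ c → parity (c + rest)) (count-at f k) ⟩
  parity ((if f k then 1 else 0) + rest)
    ≡⟨ cong (λ b → parity ((if b then 1 else 0) + rest)) fk≡ ⟩
  parity ((if evenᵇ rest then 1 else 0) + rest)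
    ≡⟨ parity-completed rest ⟩
  1ℙ ∎)
  where
  open ≡-Reasoning
  rest : ℕ
  rest = count (λ x → f x ∧ not ⌊ x ≟ k ⌋)

choose : (f : Fin n → Bool) → Fin n → Fin n
choose f default with any? (λ x → f x ≟ᵇ true)
... | yes (x , _) = x
... | no _        = default

choose-true : (f : Fin n → Bool) (default : Fin n) → ∃ (λ x → f x ≡ true) →
  f (choose f default) ≡ true
choose-true f default ∃x with any? (λ x → f x ≟ᵇ true)
... | yes (_ , fx≡) = fx≡
... | no ∄x         = ⊥-elim (∄x ∃x)

paint : Bool → Fin 2
paint b = if b then zero else suc zero

paint-colour₁ : ∀ b → ⌊ paint b ≟ zero ⌋ ≡ b
paint-colour₁ true  = refl
paint-colour₁ false = refl

module SinkColouring {n : ℕ} (D : Digraph n) (p v : Fin n) (sink : outdeg D p ≡ 0)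
  (toSink : ∀ u → u ≢ p → arc D u p ≡ true) (hasIn : ∀ w → w ≢ p → indeg D w ≢ 0) where

  inPick : Fin n → Fin n
  inPick w = choose (λ t → arc D t w) w

  picked : Fin n → Fin n → Bool
  picked t w = ⌊ t ≟ inPick w ⌋

  outRest : Fin n → ℕ
  outRest t = count (λ w → (arc D t w ∧ picked t w) ∧ not ⌊ w ≟ p ⌋)

  sinkRest : ℕ
  sinkRest = count (λ t → (arc D t p ∧ evenᵇ (outRest t)) ∧ not ⌊ t ≟ v ⌋)

  colour₁ : Fin n → Fin n → Bool
  colour₁ t w with w ≟ p | t ≟ v
  ... | no _  | _     = picked t w
  ... | yes _ | no _  = evenᵇ (outRest t)
  ... | yes _ | yes _ = evenᵇ sinkRest

  φ : Colouring n
  φ t w = paint (colour₁ t w)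

  colour₁-off-sink : ∀ {t w} → w ≢ p → colour₁ t w ≡ picked t w
  colour₁-off-sink {t} {w} w≢p with w ≟ p
  ... | yes w≡p = ⊥-elim (w≢p w≡p)
  ... | no _    = refl

  colour₁-into-sink : ∀ {t} → t ≢ v → colour₁ t p ≡ evenᵇ (outRest t)
  colour₁-into-sink {t} t≢v with p ≟ p | t ≟ v
  ... | no p≢p | _       = ⊥-elim (p≢p refl)
  ... | yes _  | yes t≡v = ⊥-elim (t≢v t≡v)
  ... | yes _  | no _    = refl

  colour₁-from-v : colour₁ v p ≡ evenᵇ sinkRest
  colour₁-from-v with p ≟ p | v ≟ v
  ... | no p≢p | _      = ⊥-elim (p≢p refl)
  ... | yes _  | no v≢v = ⊥-elim (v≢v refl)
  ... | yes _  | yes _  = refl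

  outCol≡ : ∀ u → outCol D φ zero u ≡ count (λ w → arc D u w ∧ colour₁ u w)
  outCol≡ u = count-cong (λ w → cong (arc D u w ∧_) (paint-colour₁ (colour₁ u w)))

  inCol≡ : ∀ w → inCol D φ zero w ≡ count (λ t → arc D t w ∧ colour₁ t w)
  inCol≡ w = count-cong (λ t → cong (arc D t w ∧_) (paint-colour₁ (colour₁ t w)))

  inPick-arc : ∀ {w} → w ≢ p → arc D (inPick w) w ≡ true
  inPick-arc {w} w≢p =
    choose-true (λ t → arc D t w) w (count≢0⇒∃ (λ t → arc D t w) (hasIn w w≢p))

  in-odd : ∀ {w} → w ≢ p → IsOdd (inCol D φ zero w)
  in-odd {w} w≢p = subst IsOdd (sym (begin
    inCol D φ zero w
      ≡⟨ inCol≡ w ⟩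
    count (λ t → arc D t w ∧ colour₁ t w)
      ≡⟨ count-cong (λ t → cong (arc D t w ∧_) (colour₁-off-sink w≢p)) ⟩
    count (λ t → arc D t w ∧ ⌊ t ≟ inPick w ⌋)
      ≡⟨ count-at (λ t → arc D t w) (inPick w) ⟩
    (if arc D (inPick w) w then 1 else 0)
      ≡⟨ cong (λ b → if b then 1 else 0) (inPick-arc w≢p) ⟩
    1 ∎)) refl
    where open ≡-Reasoning

  out-odd : ∀ {u} → u ≢ p → u ≢ v → IsOdd (outCol D φ zero u)
  out-odd {u} u≢p u≢v = subst IsOdd (sym (outCol≡ u)) (count-odd-by-pivot _ p (begin
    arc D u p ∧ colour₁ u p
      ≡⟨ cong₂ _∧_ (toSink u u≢p) (colour₁-into-sink u≢v) ⟩
    evenᵇ (outRest u)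
      ≡⟨ cong evenᵇ (count-except-cong p λ w w≢p →
           cong (arc D u w ∧_) (sym (colour₁-off-sink w≢p))) ⟩
    evenᵇ (count (λ w → (arc D u w ∧ colour₁ u w) ∧ not ⌊ w ≟ p ⌋)) ∎))
    where open ≡-Reasoning

  sink-in-odd : p ≢ v → IsOdd (inCol D φ zero p)
  sink-in-odd p≢v = subst IsOdd (sym (inCol≡ p)) (count-odd-by-pivot _ v (begin
    arc D v p ∧ colour₁ v p
      ≡⟨ cong₂ _∧_ (toSink v (p≢v ∘ sym)) colour₁-from-v ⟩
    evenᵇ sinkRest
      ≡⟨ cong evenᵇ (count-except-cong v λ t t≢v →
           cong (arc D t p ∧_) (sym (colour₁-into-sink t≢v))) ⟩
    evenᵇ (count (λ t → (arc D t p ∧ colour₁ t p) ∧ not ⌊ t ≟ v ⌋)) ∎))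
    where open ≡-Reasoning

  wo : ∀ u → u ≢ v → WO D φ u
  wo u u≢v = by-cases (u ≟ p)
    where
    by-cases : Dec (u ≡ p) → WO D φ u
    by-cases (yes refl) =
      zero , (λ outdeg>0 → ⊥-elim (<⇒≢ outdeg>0 (sym sink))) , (λ _ → sink-in-odd u≢v)
    by-cases (no u≢p)   = zero , (λ _ → out-odd u≢p u≢v) , (λ _ → in-odd u≢p)

sink-colouring : (D : Digraph n) → Semicomplete D → (p : Fin n) → outdeg D p ≡ 0 →
  (∀ u → Peripheral D u → u ≡ p) → (v : Fin n) →
  Σ (Colouring n) λ φ → ∀ u → u ≢ v → WO D φ u
sink-colouring D semicomplete p sink unique v = φ , wo
  where
  toSink : ∀ u → u ≢ p → arc D u p ≡ true
  toSink u u≢p = Equivalence.to T-≡ (subst T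
    (trans (cong (arc D u p ∨_) (count≡0⇒false (arc D p) sink u)) (∨-identityʳ (arc D u p)))
    (semicomplete u p u≢p))

  hasIn : ∀ w → w ≢ p → indeg D w ≢ 0
  hasIn w w≢p indeg≡0 = w≢p (unique w (inj₂ indeg≡0))

  open SinkColouring D p v sink toSink hasIn

reverse : Digraph n → Digraph n
reverse D = record { arc = flip (arc D) ; noLoop = noLoop D }

reverse-semicomplete : (D : Digraph n) → Semicomplete D → Semicomplete (reverse D)
reverse-semicomplete D semicomplete u w u≢w =
  subst T (∨-comm (arc D u w) (arc D w u)) (semicomplete u w u≢w)

WO-reverse : (D : Digraph n) (φ : Colouring n) {u : Fin n} →
  WO (reverse D) φ u → WO D (flip φ) u
WO-reverse D φ (i , out-odd , in-odd) = i , in-odd , out-odd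

proposition3p3 : (n : ℕ) → n > 1 → (D : Digraph n) → Semicomplete D →
    EvenDigraph D → ExactlyOnePeripheral D → (v : Fin n) →
    Σ (Colouring n) λ φ → (u : Fin n) → u ≢ v → WO D φ u
proposition3p3 n _ D semicomplete _ (p , inj₁ sink , unique) v =
  sink-colouring D semicomplete p sink unique v
proposition3p3 n _ D semicomplete _ (p , inj₂ source , unique) v
  with sink-colouring (reverse D) (reverse-semicomplete D semicomplete) p source
         (λ u → unique u ∘ swap) v
... | φ , wo = flip φ , λ u u≢v → WO-reverse D φ (wo u u≢v)
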